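{- Let $G$ be a finite simple connected graph satisfying property (P2), and let $c,x\in V(G)$ with $d(c,x)\ge 2$. Then for all $c_1,c_2\in N(c,x)$ we have $N[c_1]=N[c_2]$.
   Context: $d$ is the distance in $G$, $N(x)$ the neighbourhood, $N[x]=N(x)\cup\{x\}$. For $d(c,x)\ge 2$, $N(c,x)=\{v\in N(c): d(c,x)=1+d(v,x)\}$. Property (P2): for any $c,x,y\in V(G)$ and any $c'\in N(c,x)$ with $d(c,x)\ge 2$ and $d(c',y)\ge 2$, either $d(c,y)=d(c,c')+d(c',y)$ or $d(x,y)=d(x,c')+d(c',y)$. -}

module Defs where

open import Data.Nat using (ℕ; zero; suc; _+_; _≤_; _≥_)
open import Data.Fin using (Fin)
open import Data.Product using (_×_; Σ; ∃)
open import Data.Sum using (_⊎_)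
open import Data.Empty using (⊥)
open import Relation.Nullary using (¬_)
open import Relation.Binary.PropositionalEquality using (_≡_)

record SimpleGraph (n : ℕ) : Set₁ where
  field
    Adj     : Fin n → Fin n → Set
    sym     : ∀ {u v} → Adj u v → Adj v u
    irrefl  : ∀ {u} → ¬ Adj u u

open SimpleGraph public

data Walk {n : ℕ} (G : SimpleGraph n) : Fin n → Fin n → ℕ → Set where
  nil  : ∀ {u} → Walk G u u zero
  cons : ∀ {u v w k} → Adj G u v → Walk G v w k → Walk G u w (suc k)

Connected : ∀ {n} → SimpleGraph n → Set
Connected {n} G = ∀ (u v : Fin n) → ∃ λ k → Walk G u v k

IsDist : ∀ {n} → SimpleGraph n → Fin n → Fin n → ℕ → Set
IsDist G u v k = Walk G u v k × (∀ m → Walk G u v m → k ≤ m)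

IsDistFun : ∀ {n} → SimpleGraph n → (Fin n → Fin n → ℕ) → Set
IsDistFun {n} G d = ∀ (u v : Fin n) → IsDist G u v (d u v)

-- v ∈ N(c,x) (used when d(c,x) ≥ 2): v ∈ N(c) and d(c,x) = 1 + d(v,x).
InNcx : ∀ {n} → SimpleGraph n → (Fin n → Fin n → ℕ) → Fin n → Fin n → Fin n → Set
InNcx G d c x v = Adj G c v × d c x ≡ suc (d v x)

InClosedNbhd : ∀ {n} → SimpleGraph n → Fin n → Fin n → Set
InClosedNbhd G v w = w ≡ v ⊎ Adj G v w

P2 : ∀ {n} → SimpleGraph n → (Fin n → Fin n → ℕ) → Set
P2 {n} G d = ∀ (c x y c' : Fin n) → d c x ≥ 2 → InNcx G d c x c' → d c' y ≥ 2 →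
  (d c y ≡ d c c' + d c' y) ⊎ (d x y ≡ d x c' + d c' y)

-- If w ∈ N[c₁] then d(c,w) ≤ 2 and d(x,w) ≤ d(x,c₁) + 1 = d(x,c₂) + 1. Were
-- d(c₂,w) ≥ 2, property (P2) at c' = c₂, y = w would force either
-- d(c,w) ≥ 1 + 2 or d(x,w) ≥ d(x,c₂) + 2; hence d(c₂,w) ≤ 1, i.e. w ∈ N[c₂].
module Submission where

open import Defs
open import Data.Nat using (ℕ; zero; suc; _+_; _≤_; _≥_; _≤?_; z≤n; s≤s)
open import Data.Nat.Properties
  using (≤-trans; ≤-antisym; ≰⇒>; 1+n≰n; +-mono-≤; +-monoʳ-≤; +-cancelˡ-≤; suc-injective)
open import Data.Fin using (Fin)
open import Data.Product using (_,_; proj₁; proj₂)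
open import Data.Sum using (inj₁; inj₂)
open import Data.Empty using (⊥-elim)
open import Function.Bundles using (_⇔_; mk⇔)
open import Relation.Nullary using (yes; no)
open import Relation.Binary.PropositionalEquality
  using (_≡_; refl; cong; subst; trans)
  renaming (sym to ≡-sym)

module Walks {n : ℕ} (G : SimpleGraph n) where

  snoc : ∀ {u v w k} → Walk G u v k → Adj G v w → Walk G u w (suc k)
  snoc nil a        = cons a nil
  snoc (cons b p) a = cons b (snoc p a)

  reverse : ∀ {u v k} → Walk G u v k → Walk G v u k
  reverse nil        = nil
  reverse (cons a p) = snoc (reverse p) (SimpleGraph.sym G a)

  _++_ : ∀ {u v w k l} → Walk G u v k → Walk G v w l → Walk G u w (k + l)
  nil      ++ q = q
  cons a p ++ q = cons a (p ++ q)

  walk-length≤1⇒closedNbhd : ∀ {v w k} → Walk G v w k → k ≤ 1 → InClosedNbhd G v w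
  walk-length≤1⇒closedNbhd nil                 _            = inj₁ refl
  walk-length≤1⇒closedNbhd (cons a nil)        _            = inj₂ a
  walk-length≤1⇒closedNbhd (cons _ (cons _ _)) (s≤s ())

  walk-length0⇒≡ : ∀ {u v} → Walk G u v 0 → u ≡ v
  walk-length0⇒≡ nil = refl

module Distance {n : ℕ} (G : SimpleGraph n) (d : Fin n → Fin n → ℕ) (dist : IsDistFun G d) where

  open Walks G

  shortest : ∀ u v → Walk G u v (d u v)
  shortest u v = proj₁ (dist u v)

  d-minimal : ∀ {u v k} → Walk G u v k → d u v ≤ k
  d-minimal {u} {v} = proj₂ (dist u v) _

  d-sym : ∀ u v → d u v ≡ d v u
  d-sym u v = ≤-antisym (d-minimal (reverse (shortest v u))) (d-minimal (reverse (shortest u v)))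

  d-triangle : ∀ u v w → d u w ≤ d u v + d v w
  d-triangle u v w = d-minimal (shortest u v ++ shortest v w)

  closedNbhd⇒d≤1 : ∀ {v w} → InClosedNbhd G v w → d v w ≤ 1
  closedNbhd⇒d≤1 (inj₁ refl) = ≤-trans (d-minimal nil) z≤n
  closedNbhd⇒d≤1 (inj₂ a)    = d-minimal (cons a nil)

  d≤1⇒closedNbhd : ∀ {v w} → d v w ≤ 1 → InClosedNbhd G v w
  d≤1⇒closedNbhd {v} {w} = walk-length≤1⇒closedNbhd (shortest v w)

  adj⇒d≥1 : ∀ {u v} → Adj G u v → d u v ≥ 1
  adj⇒d≥1 {u} {v} a with d u v | shortest u v
  ... | zero  | p = ⊥-elim (irrefl G (subst (Adj G u) (≡-sym (walk-length0⇒≡ p)) a))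
  ... | suc _ | _ = s≤s z≤n

  P2⇒d≤1 : P2 G d → ∀ {c x c' y} → d c x ≥ 2 → InNcx G d c x c' →
    d c y ≤ 2 → d x y ≤ d x c' + 1 → d c' y ≤ 1
  P2⇒d≤1 p2 {c} {x} {c'} {y} cx≥2 c'∈N dcy≤2 dxy≤ with d c' y ≤? 1
  ... | yes c'y≤1 = c'y≤1
  ... | no  c'y≰1 with p2 c x y c' cx≥2 c'∈N (≰⇒> c'y≰1)
  ...   | inj₁ dcy≡ = ⊥-elim (1+n≰n (begin
            3                    ≤⟨ +-mono-≤ (adj⇒d≥1 (proj₁ c'∈N)) (≰⇒> c'y≰1) ⟩
            d c c' + d c' y      ≡⟨ ≡-sym dcy≡ ⟩
            d c y                ≤⟨ dcy≤2 ⟩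
            2                    ∎))
    where open Data.Nat.Properties.≤-Reasoning
  ...   | inj₂ dxy≡ = ⊥-elim (1+n≰n (+-cancelˡ-≤ (d x c') 2 1 (begin
            d x c' + 2           ≤⟨ +-monoʳ-≤ (d x c') (≰⇒> c'y≰1) ⟩
            d x c' + d c' y      ≡⟨ ≡-sym dxy≡ ⟩
            d x y                ≤⟨ dxy≤ ⟩
            d x c' + 1           ∎)))
    where open Data.Nat.Properties.≤-Reasoning

corollary3 : ∀ {n} (G : SimpleGraph n) (d : Fin n → Fin n → ℕ) →
    IsDistFun G d → Connected G → P2 G d →
    ∀ (c x : Fin n) → d c x ≥ 2 →
    ∀ (c₁ c₂ : Fin n) → InNcx G d c x c₁ → InNcx G d c x c₂ →
    ∀ (w : Fin n) → InClosedNbhd G c₁ w ⇔ InClosedNbhd G c₂ w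
corollary3 G d dist _ p2 c x cx≥2 c₁ c₂ c₁∈N c₂∈N w =
  mk⇔ (closedNbhd-⊆ c₁∈N c₂∈N) (closedNbhd-⊆ c₂∈N c₁∈N)
  where
  open Distance G d dist
  closedNbhd-⊆ : ∀ {a b} → InNcx G d c x a → InNcx G d c x b →
    InClosedNbhd G a w → InClosedNbhd G b w
  closedNbhd-⊆ {a} {b} (ca , cx≡a) b∈N@(_ , cx≡b) w∈N[a] =
    d≤1⇒closedNbhd (P2⇒d≤1 p2 cx≥2 b∈N dcw≤2 dxw≤)
    where
    open Data.Nat.Properties.≤-Reasoning
    dxa≡dxb : d x a ≡ d x b
    dxa≡dxb = trans (d-sym x a) (trans (suc-injective (trans (≡-sym cx≡a) cx≡b)) (d-sym b x))
    dcw≤2 : d c w ≤ 2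
    dcw≤2 = ≤-trans (d-triangle c a w) (+-mono-≤ (closedNbhd⇒d≤1 (inj₂ ca)) (closedNbhd⇒d≤1 w∈N[a]))
    dxw≤ : d x w ≤ d x b + 1
    dxw≤ = begin
      d x w         ≤⟨ d-triangle x a w ⟩
      d x a + d a w ≤⟨ +-monoʳ-≤ (d x a) (closedNbhd⇒d≤1 w∈N[a]) ⟩
      d x a + 1     ≡⟨ cong (_+ 1) dxa≡dxb ⟩
      d x b + 1     ∎
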